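{- Let $\alpha\in\mathrm{Comp}'_n$ and let $\beta$ be a composition of $n$, with $N\ge n$. The coefficient of $G_\beta(x_1,\ldots,x_N;t)$ in the expansion of the peak quasisymmetric function $K_\alpha$ in the basis $\{G_\gamma\}$ equals $k(\alpha,\beta)$ if $\mathrm{sub}(\alpha)\subseteq\mathrm{sub}(\beta)\cup(\mathrm{sub}(\beta)+1)$, and $0$ otherwise.
   Context: For a composition $\alpha$ of $n$, $\mathrm{sub}(\alpha)\subseteq[n-1]$ is its set of proper partial sums $\{\alpha_1,\alpha_1+\alpha_2,\ldots\}$. For $B\subseteq[n-1]$, $B+1=\{b+1:b\in B\}\setminus\{n\}$ and $B-1=\{b-1:b\in B\}\setminus\{0\}$; $\triangle$ is symmetric difference. $\mathrm{Comp}'_n$ is the set of compositions $\alpha$ of $n$ such that $\mathrm{sub}(\alpha)$ contains no two consecutive integers. $F_\beta(x_1,\ldots,x_N)=\sum x_{w_1}\cdots x_{w_n}$ over $1\le w_1\le\dots\le w_n\le N$ with $w_j<w_{j+1}$ for $j\in\mathrm{sub}(\beta)$; the peak quasisymmetric function is $K_\alpha=\sum_{\beta:\ \mathrm{sub}(\alpha)\subseteq\mathrm{sub}(\beta)\triangle(\mathrm{sub}(\beta)+1)}F_\beta$. With $\gamma\succeq\alpha$ iff $\mathrm{sub}(\alpha)\subseteq\mathrm{sub}(\gamma)$, and for such pairs $s(\alpha,\gamma)=\sum_j j(i_j-i_{j-1}-1)$ where $\alpha_j=\gamma_{i_{j-1}+1}+\dots+\gamma_{i_j}$, $0=i_0<\dots<i_k=\ell(\gamma)$,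 Hivert's quasisymmetric Hall–Littlewood polynomials are $G_\alpha=\sum_{\gamma\succeq\alpha}(-1)^{\ell(\gamma)-\ell(\alpha)}t^{s(\alpha,\gamma)}F_\gamma$. Write $\mathrm{sub}(\beta)=\{b_1<\dots<b_p\}$. For each $i$, $k(b_i)=1+t^i$ if $b_i\notin\mathrm{sub}(\alpha)\cup(\mathrm{sub}(\alpha)-1)$; $k(b_i)=t^{i-1}+t^i$ if $b_i\in\mathrm{sub}(\alpha)$ and $b_i-1=b_{i-1}$; and $k(b_i)=1$ otherwise. Then $k(\alpha,\beta)=\prod_{i=1}^p k(b_i)$. -}

module Defs where

open import Data.Bool using (Bool; true; false; if_then_else_; _∧_; not)
open import Data.Nat using (ℕ; zero; suc; _+_; _*_; _∸_; _≤_; _≡ᵇ_; _<ᵇ_)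
open import Data.Integer as ℤ using (ℤ)
open import Data.List using (List; []; _∷_; map; length; foldr; _++_)
open import Data.Bool.ListAction using (all; any)
open import Data.Nat.ListAction using (sum)
open import Data.List.Relation.Unary.All using (All)
open import Data.List.Relation.Unary.Linked using (Linked)
open import Data.List.Membership.Propositional using (_∈_)
open import Data.Maybe using (Maybe; just; nothing)
open import Data.Product using (_×_; _,_)
open import Data.Empty using (⊥)
open import Relation.Binary.PropositionalEquality using (_≡_)

-- The coefficient ring ℤ[t]: an element is its coefficient sequence
-- (p k = coefficient of t^k); equality is coefficientwise.

Zt : Set
Zt = ℕ → ℤ

0ₜ : Zt
0ₜ _ = ℤ.0ℤ

1ₜ : Zt
1ₜ zero    = ℤ.1ℤ
1ₜ (suc _) = ℤ.0ℤ

tpow : ℕ → Zt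
tpow i k = if i ≡ᵇ k then ℤ.1ℤ else ℤ.0ℤ

_+ₜ_ : Zt → Zt → Zt
(p +ₜ q) k = p k ℤ.+ q k

-ₜ_ : Zt → Zt
(-ₜ p) k = ℤ.- p k

convSum : Zt → Zt → ℕ → ℕ → ℤ
convSum p q k zero    = p 0 ℤ.* q k
convSum p q k (suc m) = convSum p q k m ℤ.+ p (suc m) ℤ.* q (k ∸ suc m)

_*ₜ_ : Zt → Zt → Zt
(p *ₜ q) k = convSum p q k k

sumₜ : List Zt → Zt
sumₜ = foldr _+ₜ_ 0ₜ

prodₜ : List Zt → Zt
prodₜ = foldr _*ₜ_ 1ₜ

signₜ : ℕ → Zt
signₜ zero          = 1ₜ
signₜ (suc zero)    = -ₜ 1ₜ
signₜ (suc (suc m)) = signₜ m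

_≈ₜ_ : Zt → Zt → Set
p ≈ₜ q = ∀ k → p k ≡ q k

filterB : (ℕ → Bool) → List ℕ → List ℕ
filterB p [] = []
filterB p (x ∷ xs) = if p x then x ∷ filterB p xs else filterB p xs

_∈ᵇ_ : ℕ → List ℕ → Bool
x ∈ᵇ B = any (λ y → x ≡ᵇ y) B

_⊆ᵇ_ : List ℕ → List ℕ → Bool
A ⊆ᵇ B = all (λ x → x ∈ᵇ B) A

symDiff : List ℕ → List ℕ → List ℕ
symDiff A B = filterB (λ x → not (x ∈ᵇ B)) A ++ filterB (λ x → not (x ∈ᵇ A)) B

_∪_ : List ℕ → List ℕ → List ℕ
A ∪ B = A ++ B

shiftUp : ℕ → List ℕ → List ℕ
shiftUp n B = filterB (λ x → not (x ≡ᵇ n)) (map suc B)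

shiftDown : List ℕ → List ℕ
shiftDown B = filterB (λ x → not (x ≡ᵇ 0)) (map (λ b → b ∸ 1) B)

IsComp : ℕ → List ℕ → Set
IsComp n α = All (λ a → 1 ≤ a) α × sum α ≡ n

sub : List ℕ → List ℕ
sub []            = []
sub (a ∷ [])      = []
sub (a ∷ b ∷ r)   = a ∷ map (a +_) (sub (b ∷ r))

-- α ∈ Comp'_n (given α is a composition of n): sub α has no two
-- consecutive integers
NoConsec : List ℕ → Set
NoConsec α = ∀ x → x ∈ sub α → suc x ∈ sub α → ⊥

incHead : List ℕ → List ℕ
incHead []      = []
incHead (a ∷ r) = suc a ∷ r

comps : ℕ → List (List ℕ)
comps zero          = [] ∷ []
comps (suc zero)    = (1 ∷ []) ∷ []
comps (suc (suc m)) = map (1 ∷_) (comps (suc m)) ++ map incHead (comps (suc m))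

takeParts : ℕ → List ℕ → ℕ × List ℕ
takeParts zero    gs       = 0 , gs
takeParts (suc a) []       = 0 , []
takeParts (suc a) (g ∷ gs) with takeParts (suc a ∸ g) gs
... | c , r = suc c , r

-- blocks α γ = (i_1 - i_0 , i_2 - i_1 , … , i_k - i_{k-1})
blocks : List ℕ → List ℕ → List ℕ
blocks []       gs = []
blocks (a ∷ as) gs with takeParts a gs
... | c , r = c ∷ blocks as r

weighted : ℕ → List ℕ → ℕ
weighted j []       = 0
weighted j (c ∷ cs) = j * (c ∸ 1) + weighted (suc j) cs

s : List ℕ → List ℕ → ℕ
s α γ = weighted 1 (blocks α γ)

-- A homogeneous polynomial of degree n is given by its coefficient
-- function on monomials; the monomial x_{w_1} ⋯ x_{w_n} is indexed by
-- the unique weakly increasing word w = w_1 … w_n with 1 ≤ w_j ≤ N.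

IsWord : ℕ → ℕ → List ℕ → Set
IsWord n N w = length w ≡ n × All (λ e → 1 ≤ e × e ≤ N) w × Linked _≤_ w

Pol : Set
Pol = List ℕ → Zt

_≈[_,_]_ : Pol → ℕ → ℕ → Pol → Set
f ≈[ n , N ] g = ∀ w → IsWord n N w → f w ≈ₜ g w

-- w_j (1-indexed)
at : List ℕ → ℕ → ℕ
at []       _             = 0
at (x ∷ xs) zero          = 0
at (x ∷ xs) (suc zero)    = x
at (x ∷ xs) (suc (suc j)) = at xs (suc j)

F : List ℕ → Pol
F β w = if all (λ j → at w j <ᵇ at w (suc j)) (sub β) then 1ₜ else 0ₜ

K : ℕ → List ℕ → Pol
K n α w = sumₜ (map (λ β → if sub α ⊆ᵇ symDiff (sub β) (shiftUp n (sub β))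
                             then F β w else 0ₜ) (comps n))

G : ℕ → List ℕ → Pol
G n α w = sumₜ (map (λ γ → if sub α ⊆ᵇ sub γ
                             then (signₜ (length γ ∸ length α) *ₜ tpow (s α γ)) *ₜ F γ w
                             else 0ₜ) (comps n))

kfac : List ℕ → ℕ → Maybe ℕ → ℕ → Zt
kfac A i prev b =
  if not (b ∈ᵇ (A ∪ shiftDown A)) then 1ₜ +ₜ tpow i
  else if (b ∈ᵇ A) ∧ prevOK prev then tpow (i ∸ 1) +ₜ tpow i
  else 1ₜ
  where
  prevOK : Maybe ℕ → Bool
  prevOK nothing  = false
  prevOK (just p) = (b ∸ 1) ≡ᵇ p

kfacs : List ℕ → ℕ → Maybe ℕ → List ℕ → List Zt
kfacs A i prev []       = []
kfacs A i prev (b ∷ bs) = kfac A i prev b ∷ kfacs A (suc i) (just b) bs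

kcoef : List ℕ → List ℕ → Zt
kcoef α β = prodₜ (kfacs (sub α) 1 nothing (sub β))

coeffKG : ℕ → List ℕ → List ℕ → Zt
coeffKG n α β = if sub α ⊆ᵇ (sub β ∪ shiftUp n (sub β)) then kcoef α β else 0ₜ

IsGExpansion : ℕ → ℕ → Pol → (List ℕ → Zt) → Set
IsGExpansion n N f c = f ≈[ n , N ] (λ w → sumₜ (map (λ β → c β *ₜ G n β w) (comps n)))

-- Expanding every G_β in fundamental functions, Σ_β c(β) G_β = Σ_γ (Σ_β c(β) h(β,γ)) F_γ
-- with h(β,γ) = [sub β ⊆ sub γ] (-1)^(ℓ(γ)-ℓ(β)) t^s(β,γ), while K_α is by definition
-- Σ_γ [sub α ⊆ sub γ △ (sub γ + 1)] F_γ.  So it suffices to show that Σ_β c(β) h(β,γ)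
-- is that indicator, for each γ.  Encode a composition of m + 1 by the bit vector of
-- its set sub(·) ⊆ [m].  Every ingredient of c(β) h(β,γ) is then local: the conditions
-- sub α ⊆ sub β ∪ (sub β + 1) and sub β ⊆ sub γ, the factors k(b_i), and the factor
-- -t^j of each cut of γ inside the j-th part of β depend only on the bits at one
-- position and its neighbours.  Summing out the bits of β one position at a time, what
-- remains depends on the bits already chosen only through the current part index j and
-- the last bit chosen, and it has a closed form of the same shape at every step because
-- sub α has no two consecutive elements.  At the first position the closed form is the
-- indicator of sub α ⊆ sub γ △ (sub γ + 1).

module Submission where

open import Defs
open import Algebra.Bundles using (CommutativeRing)
import Algebra.Properties.CommutativeSemigroup as CommSemigroupProperties
import Algebra.Solver.Ring
open import Algebra.Solver.Ring.AlmostCommutativeRing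
  using (fromCommutativeRing; _-Raw-AlmostCommutative⟶_)
open import Data.Bool using (Bool; true; false; if_then_else_; _∧_; _∨_; not; _xor_)
import Data.Bool.Properties as BoolP
open import Data.Empty using (⊥; ⊥-elim)
open import Data.Integer as ℤ using (ℤ)
import Data.Integer.Properties as ℤP
open import Data.Integer.Solver using (module +-*-Solver)
open import Data.List using (List; []; _∷_; map; length; _++_; foldr; replicate)
import Data.List.Properties as ListP
open import Data.List.Membership.Propositional using (_∈_)
open import Data.List.Membership.Propositional.Properties using (∈-map⁻; ∈-++⁻)
open import Data.List.Relation.Unary.All using (All; _∷_)
open import Data.List.Relation.Unary.Any using (here; there)
open import Data.Maybe using (Maybe; just; nothing)
open import Data.Nat
  using (ℕ; zero; suc; _+_; _∸_; _≤_; _<_; z≤n; s≤s; _≡ᵇ_; ≤′-refl; ≤′-step)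
import Data.Nat.Properties as ℕP
open import Data.Nat.ListAction using (sum)
open import Data.Product using (Σ; _×_; _,_; proj₁; proj₂)
open import Data.Sum using (inj₁; inj₂)
open import Data.Unit using (⊤; tt)
open import Relation.Binary.PropositionalEquality
  using (_≡_; _≢_; refl; sym; trans; cong; cong₂; subst; module ≡-Reasoning)
import Relation.Binary.Reasoning.Setoid
open import Relation.Nullary using (yes; no)

-- The coefficient ring ℤ[t]

private module ℤ+ = CommSemigroupProperties ℤP.+-commutativeSemigroup

shift : Zt → Zt
shift p k = p (suc k)

-- The coefficients of a product by recursion on the degree rather than as a
-- convolution sum; the ring laws then follow by induction on the degree.
cauchy : Zt → Zt → Zt
cauchy p q zero    = p 0 ℤ.* q 0
cauchy p q (suc k) = p 0 ℤ.* q (suc k) ℤ.+ cauchy (shift p) q k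

convSum-suc : ∀ p q k m →
  convSum p q (suc k) (suc m) ≡ p 0 ℤ.* q (suc k) ℤ.+ convSum (shift p) q k m
convSum-suc p q k zero    = refl
convSum-suc p q k (suc m) rewrite convSum-suc p q k m = ℤP.+-assoc (p 0 ℤ.* q (suc k)) _ _

*ₜ≡cauchy : ∀ p q k → (p *ₜ q) k ≡ cauchy p q k
*ₜ≡cauchy p q zero    = refl
*ₜ≡cauchy p q (suc k) =
  trans (convSum-suc p q k k) (cong (ℤ._+_ (p 0 ℤ.* q (suc k))) (*ₜ≡cauchy (shift p) q k))

cauchy-sucʳ : ∀ p q k → cauchy p q (suc k) ≡ p (suc k) ℤ.* q 0 ℤ.+ cauchy p (shift q) k
cauchy-sucʳ p q zero    = ℤP.+-comm (p 0 ℤ.* q 1) (p 1 ℤ.* q 0)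
cauchy-sucʳ p q (suc k) rewrite cauchy-sucʳ (shift p) q k =
  ℤ+.x∙yz≈y∙xz (p 0 ℤ.* q (suc (suc k))) (p (suc (suc k)) ℤ.* q 0) (cauchy (shift p) (shift q) k)

cauchy-comm : ∀ p q k → cauchy p q k ≡ cauchy q p k
cauchy-comm p q zero    = ℤP.*-comm (p 0) (q 0)
cauchy-comm p q (suc k)
  rewrite cauchy-sucʳ q p k | cauchy-comm (shift p) q k | ℤP.*-comm (p 0) (q (suc k)) = refl

cauchy-cong : ∀ {p p′ q q′} → p ≈ₜ p′ → q ≈ₜ q′ → ∀ k → cauchy p q k ≡ cauchy p′ q′ k
cauchy-cong p≈ q≈ zero    = cong₂ ℤ._*_ (p≈ 0) (q≈ 0)
cauchy-cong p≈ q≈ (suc k) =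
  cong₂ ℤ._+_ (cong₂ ℤ._*_ (p≈ 0) (q≈ (suc k))) (cauchy-cong (λ i → p≈ (suc i)) q≈ k)

cauchy-distribˡ : ∀ p q r k → cauchy p (q +ₜ r) k ≡ cauchy p q k ℤ.+ cauchy p r k
cauchy-distribˡ p q r zero    = ℤP.*-distribˡ-+ (p 0) (q 0) (r 0)
cauchy-distribˡ p q r (suc k)
  rewrite cauchy-distribˡ (shift p) q r k | ℤP.*-distribˡ-+ (p 0) (q (suc k)) (r (suc k)) =
  ℤ+.interchange (p 0 ℤ.* q (suc k)) (p 0 ℤ.* r (suc k)) (cauchy (shift p) q k) (cauchy (shift p) r k)

cauchy-distribʳ : ∀ p q r k → cauchy (q +ₜ r) p k ≡ cauchy q p k ℤ.+ cauchy r p k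
cauchy-distribʳ p q r k
  rewrite cauchy-comm (q +ₜ r) p k | cauchy-comm q p k | cauchy-comm r p k = cauchy-distribˡ p q r k

cauchy-zeroˡ : ∀ q k → cauchy 0ₜ q k ≡ ℤ.0ℤ
cauchy-zeroˡ q zero    = refl
cauchy-zeroˡ q (suc k) rewrite cauchy-zeroˡ q k = refl

cauchy-identityˡ : ∀ q k → cauchy 1ₜ q k ≡ q k
cauchy-identityˡ q zero    = ℤP.*-identityˡ (q 0)
cauchy-identityˡ q (suc k) rewrite cauchy-zeroˡ q k = trans (ℤP.+-identityʳ _) (ℤP.*-identityˡ (q (suc k)))

cauchy-scaleˡ : ∀ c p q k → cauchy (λ i → c ℤ.* p i) q k ≡ c ℤ.* cauchy p q k
cauchy-scaleˡ c p q zero    = ℤP.*-assoc c (p 0) (q 0)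
cauchy-scaleˡ c p q (suc k)
  rewrite cauchy-scaleˡ c (shift p) q k | ℤP.*-assoc c (p 0) (q (suc k)) = sym (ℤP.*-distribˡ-+ c _ _)

cauchy-assoc : ∀ p q r k → cauchy (cauchy p q) r k ≡ cauchy p (cauchy q r) k
cauchy-assoc p q r zero    = ℤP.*-assoc (p 0) (q 0) (r 0)
cauchy-assoc p q r (suc k) = begin
  cauchy p q 0 ℤ.* r (suc k) ℤ.+ cauchy (shift (cauchy p q)) r k
    ≡⟨ cong (ℤ._+_ (cauchy p q 0 ℤ.* r (suc k)))
            (cauchy-distribʳ r (λ i → p 0 ℤ.* q (suc i)) (cauchy (shift p) q) k) ⟩
  cauchy p q 0 ℤ.* r (suc k) ℤ.+ (cauchy (λ i → p 0 ℤ.* q (suc i)) r k ℤ.+ cauchy (cauchy (shift p) q) r k)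
    ≡⟨ cong₂ (λ x y → cauchy p q 0 ℤ.* r (suc k) ℤ.+ (x ℤ.+ y))
             (cauchy-scaleˡ (p 0) (shift q) r k) (cauchy-assoc (shift p) q r k) ⟩
  (p 0 ℤ.* q 0) ℤ.* r (suc k) ℤ.+ (p 0 ℤ.* cauchy (shift q) r k ℤ.+ cauchy (shift p) (cauchy q r) k)
    ≡⟨ solve 5 (λ a b c d e → (a :* b) :* c :+ (a :* d :+ e) := a :* (b :* c :+ d) :+ e) refl
             (p 0) (q 0) (r (suc k)) (cauchy (shift q) r k) (cauchy (shift p) (cauchy q r) k) ⟩
  p 0 ℤ.* cauchy q r (suc k) ℤ.+ cauchy (shift p) (cauchy q r) k ∎
  where open ≡-Reasoning
        open +-*-Solver

constant : ℤ → Zt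
constant c zero    = c
constant c (suc _) = ℤ.0ℤ

-- A record, not ≈ₜ itself, so that both sides can be inferred from a proof.
record _≋_ (p q : Zt) : Set where
  constructor mk≋
  field get : p ≈ₜ q
open _≋_ public

infix  4 _≋_
infixl 6 _⊕_
infixl 7 _⊗_
infix  8 ⊖_

-- Opaque copies of the operations: being neither lambdas nor reducible,
-- they let unification recover the operands of ring-law instances.
opaque
  _⊕_ _⊗_ : Zt → Zt → Zt
  _⊕_ = _+ₜ_
  _⊗_ = _*ₜ_

  ⊖_ : Zt → Zt
  ⊖_ = -ₜ_

opaque
  unfolding _⊕_ _⊗_ ⊖_

  +ₜ≋⊕ : ∀ p q → p +ₜ q ≋ p ⊕ q
  +ₜ≋⊕ p q = mk≋ λ _ → refl

  *ₜ≋⊗ : ∀ p q → p *ₜ q ≋ p ⊗ q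
  *ₜ≋⊗ p q = mk≋ λ _ → refl

  -ₜ≋⊖ : ∀ p → -ₜ p ≋ ⊖ p
  -ₜ≋⊖ p = mk≋ λ _ → refl

  ⊕-cong : ∀ {p p′ q q′} → p ≋ p′ → q ≋ q′ → p ⊕ q ≋ p′ ⊕ q′
  ⊕-cong e f = mk≋ λ k → cong₂ ℤ._+_ (get e k) (get f k)

  ⊕-assoc : ∀ p q r → (p ⊕ q) ⊕ r ≋ p ⊕ (q ⊕ r)
  ⊕-assoc p q r = mk≋ λ k → ℤP.+-assoc (p k) (q k) (r k)

  ⊕-comm : ∀ p q → p ⊕ q ≋ q ⊕ p
  ⊕-comm p q = mk≋ λ k → ℤP.+-comm (p k) (q k)

  ⊕-identityˡ : ∀ p → 0ₜ ⊕ p ≋ p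
  ⊕-identityˡ p = mk≋ λ k → ℤP.+-identityˡ (p k)

  ⊕-identityʳ : ∀ p → p ⊕ 0ₜ ≋ p
  ⊕-identityʳ p = mk≋ λ k → ℤP.+-identityʳ (p k)

  ⊖-inverseˡ : ∀ p → ⊖ p ⊕ p ≋ 0ₜ
  ⊖-inverseˡ p = mk≋ λ k → ℤP.+-inverseˡ (p k)

  ⊖-inverseʳ : ∀ p → p ⊕ ⊖ p ≋ 0ₜ
  ⊖-inverseʳ p = mk≋ λ k → ℤP.+-inverseʳ (p k)

  ⊖-cong : ∀ {p q} → p ≋ q → ⊖ p ≋ ⊖ q
  ⊖-cong e = mk≋ λ k → cong ℤ.-_ (get e k)

  ⊗-cong : ∀ {p p′ q q′} → p ≋ p′ → q ≋ q′ → p ⊗ q ≋ p′ ⊗ q′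
  ⊗-cong {p} {p′} {q} {q′} e f = mk≋ λ k → begin
    (p *ₜ q) k       ≡⟨ *ₜ≡cauchy p q k ⟩
    cauchy p q k     ≡⟨ cauchy-cong (get e) (get f) k ⟩
    cauchy p′ q′ k   ≡⟨ *ₜ≡cauchy p′ q′ k ⟨
    (p′ *ₜ q′) k     ∎
    where open ≡-Reasoning

  ⊗-assoc : ∀ p q r → (p ⊗ q) ⊗ r ≋ p ⊗ (q ⊗ r)
  ⊗-assoc p q r = mk≋ λ k → begin
    ((p *ₜ q) *ₜ r) k          ≡⟨ *ₜ≡cauchy (p *ₜ q) r k ⟩
    cauchy (p *ₜ q) r k        ≡⟨ cauchy-cong (*ₜ≡cauchy p q) (λ _ → refl) k ⟩
    cauchy (cauchy p q) r k    ≡⟨ cauchy-assoc p q r k ⟩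
    cauchy p (cauchy q r) k    ≡⟨ cauchy-cong (λ _ → refl) (*ₜ≡cauchy q r) k ⟨
    cauchy p (q *ₜ r) k        ≡⟨ *ₜ≡cauchy p (q *ₜ r) k ⟨
    (p *ₜ (q *ₜ r)) k          ∎
    where open ≡-Reasoning

  ⊗-comm : ∀ p q → p ⊗ q ≋ q ⊗ p
  ⊗-comm p q = mk≋ λ k → begin
    (p *ₜ q) k     ≡⟨ *ₜ≡cauchy p q k ⟩
    cauchy p q k   ≡⟨ cauchy-comm p q k ⟩
    cauchy q p k   ≡⟨ *ₜ≡cauchy q p k ⟨
    (q *ₜ p) k     ∎
    where open ≡-Reasoning

  ⊗-identityˡ : ∀ p → 1ₜ ⊗ p ≋ p
  ⊗-identityˡ p = mk≋ λ k → trans (*ₜ≡cauchy 1ₜ p k) (cauchy-identityˡ p k)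

  ⊗-identityʳ : ∀ p → p ⊗ 1ₜ ≋ p
  ⊗-identityʳ p = mk≋ λ k →
    trans (*ₜ≡cauchy p 1ₜ k) (trans (cauchy-comm p 1ₜ k) (cauchy-identityˡ p k))

  ⊗-distribˡ-⊕ : ∀ p q r → p ⊗ (q ⊕ r) ≋ p ⊗ q ⊕ p ⊗ r
  ⊗-distribˡ-⊕ p q r = mk≋ λ k → begin
    (p *ₜ (q +ₜ r)) k                 ≡⟨ *ₜ≡cauchy p (q +ₜ r) k ⟩
    cauchy p (q +ₜ r) k               ≡⟨ cauchy-distribˡ p q r k ⟩
    cauchy p q k ℤ.+ cauchy p r k     ≡⟨ cong₂ ℤ._+_ (*ₜ≡cauchy p q k) (*ₜ≡cauchy p r k) ⟨
    (p *ₜ q) k ℤ.+ (p *ₜ r) k         ∎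
    where open ≡-Reasoning

  ⊗-distribʳ-⊕ : ∀ p q r → (q ⊕ r) ⊗ p ≋ q ⊗ p ⊕ r ⊗ p
  ⊗-distribʳ-⊕ p q r = mk≋ λ k → begin
    ((q +ₜ r) *ₜ p) k                 ≡⟨ *ₜ≡cauchy (q +ₜ r) p k ⟩
    cauchy (q +ₜ r) p k               ≡⟨ cauchy-distribʳ p q r k ⟩
    cauchy q p k ℤ.+ cauchy r p k     ≡⟨ cong₂ ℤ._+_ (*ₜ≡cauchy q p k) (*ₜ≡cauchy r p k) ⟨
    (q *ₜ p) k ℤ.+ (r *ₜ p) k         ∎
    where open ≡-Reasoning

  constant-+ : ∀ a b → constant a ⊕ constant b ≋ constant (a ℤ.+ b)
  constant-+ a b = mk≋ λ { zero → refl ; (suc _) → refl }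

  constant-* : ∀ a b → constant a ⊗ constant b ≋ constant (a ℤ.* b)
  constant-* a b = mk≋ λ
    { zero    → refl
    ; (suc k) → trans (*ₜ≡cauchy (constant a) (constant b) (suc k))
                      (trans (cong (ℤ._+_ (a ℤ.* ℤ.0ℤ)) (cauchy-zeroˡ (constant b) k))
                             (trans (ℤP.+-identityʳ _) (ℤP.*-zeroʳ a)))
    }

  constant-neg : ∀ a → ⊖ constant a ≋ constant (ℤ.- a)
  constant-neg a = mk≋ λ { zero → refl ; (suc _) → refl }

ℤ[t] : CommutativeRing _ _
ℤ[t] = record
  { Carrier = Zt ; _≈_ = _≋_ ; _+_ = _⊕_ ; _*_ = _⊗_ ; -_ = ⊖_ ; 0# = 0ₜ ; 1# = 1ₜ
  ; isCommutativeRing = record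
    { isRing = record
      { +-isAbelianGroup = record
        { isGroup = record
          { isMonoid = record
            { isSemigroup = record
              { isMagma = record
                { isEquivalence = record
                  { refl  = mk≋ λ _ → refl
                  ; sym   = λ e → mk≋ λ k → sym (get e k)
                  ; trans = λ e f → mk≋ λ k → trans (get e k) (get f k)
                  }
                ; ∙-cong = ⊕-cong
                }
              ; assoc = ⊕-assoc
              }
            ; identity = ⊕-identityˡ , ⊕-identityʳ
            }
          ; inverse = ⊖-inverseˡ , ⊖-inverseʳ
          ; ⁻¹-cong = ⊖-cong
          }
        ; comm = ⊕-comm
        }
      ; *-cong = ⊗-cong
      ; *-assoc = ⊗-assoc
      ; *-identity = ⊗-identityˡ , ⊗-identityʳ
      ; distrib = ⊗-distribˡ-⊕ , ⊗-distribʳ-⊕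
      }
    ; *-comm = ⊗-comm
    }
  }

open CommutativeRing ℤ[t] public
  using (zeroˡ; zeroʳ; +-commutativeSemigroup)
  renaming (setoid to ≋-setoid; refl to ≋-refl; sym to ≋-sym; trans to ≋-trans)
module ≋-Reasoning = Relation.Binary.Reasoning.Setoid ≋-setoid

≡⇒≋ : ∀ {p q} → p ≡ q → p ≋ q
≡⇒≋ refl = ≋-refl

-- 0 and 1 go to 0ₜ and 1ₜ themselves, so that solver terms built from the
-- constants 0 and 1 denote exactly the terms occurring in goals.
embed : ℤ → Zt
embed (ℤ.+ 0) = 0ₜ
embed (ℤ.+ 1) = 1ₜ
embed c       = constant c

embed≋constant : ∀ c → embed c ≋ constant c
embed≋constant (ℤ.+ 0)             = mk≋ λ { zero → refl ; (suc _) → refl }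
embed≋constant (ℤ.+ 1)             = mk≋ λ { zero → refl ; (suc _) → refl }
embed≋constant (ℤ.+ suc (suc _))   = ≋-refl
embed≋constant ℤ.-[1+ _ ]          = ≋-refl

embed-morphism : CommutativeRing.rawRing ℤP.+-*-commutativeRing
                   -Raw-AlmostCommutative⟶ fromCommutativeRing ℤ[t]
embed-morphism = record
  { ⟦_⟧    = embed
  ; +-homo = λ a b → ≋-trans (embed≋constant (a ℤ.+ b))
                     (≋-sym (≋-trans (⊕-cong (embed≋constant a) (embed≋constant b)) (constant-+ a b)))
  ; *-homo = λ a b → ≋-trans (embed≋constant (a ℤ.* b))
                     (≋-sym (≋-trans (⊗-cong (embed≋constant a) (embed≋constant b)) (constant-* a b)))
  ; -‿homo = λ a → ≋-trans (embed≋constant (ℤ.- a))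
                     (≋-sym (≋-trans (⊖-cong (embed≋constant a)) (constant-neg a)))
  ; 0-homo = ≋-refl
  ; 1-homo = ≋-refl
  }

embed-≟ : ∀ a b → Maybe (embed a ≋ embed b)
embed-≟ a b with a ℤ.≟ b
... | yes refl = just ≋-refl
... | no _     = nothing

module ℤ[t]-Solver = Algebra.Solver.Ring _ _ embed-morphism embed-≟
open ℤ[t]-Solver using (solve; _:+_; _:*_; :-_; _:=_; con; Polynomial)

private
  𝟎 𝟏 : ∀ {n} → Polynomial n
  𝟎 = con (ℤ.+ 0)
  𝟏 = con (ℤ.+ 1)

private module ⊕ = CommSemigroupProperties +-commutativeSemigroup

𝟙 : Bool → Zt
𝟙 true  = 1ₜ
𝟙 false = 0ₜ

if-then-0≋𝟙⊗ : ∀ c p → (if c then p else 0ₜ) ≋ 𝟙 c ⊗ p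
if-then-0≋𝟙⊗ true  p = ≋-sym (⊗-identityˡ p)
if-then-0≋𝟙⊗ false p = ≋-sym (zeroˡ p)

𝟙-∧ : ∀ c e → 𝟙 (c ∧ e) ≋ 𝟙 c ⊗ 𝟙 e
𝟙-∧ true  e = ≋-sym (⊗-identityˡ (𝟙 e))
𝟙-∧ false e = ≋-sym (zeroˡ (𝟙 e))

tpow-zero : tpow 0 ≋ 1ₜ
tpow-zero = mk≋ λ { zero → refl ; (suc _) → refl }

tpow-suc : ∀ a → tpow (suc a) ≋ tpow 1 ⊗ tpow a
tpow-suc a = ≋-trans (mk≋ coefficients) (*ₜ≋⊗ (tpow 1) (tpow a))
  where
  open ≡-Reasoning
  coefficients : tpow (suc a) ≈ₜ (tpow 1 *ₜ tpow a)
  coefficients zero    = sym (trans (*ₜ≡cauchy (tpow 1) (tpow a) 0) (ℤP.*-zeroˡ (tpow a 0)))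
  coefficients (suc k) = sym (begin
    (tpow 1 *ₜ tpow a) (suc k)                       ≡⟨ *ₜ≡cauchy (tpow 1) (tpow a) (suc k) ⟩
    ℤ.0ℤ ℤ.* tpow a (suc k) ℤ.+ cauchy (tpow 0) (tpow a) k
      ≡⟨ cong₂ ℤ._+_ (ℤP.*-zeroˡ (tpow a (suc k))) (cauchy-cong (get tpow-zero) (λ _ → refl) k) ⟩
    ℤ.0ℤ ℤ.+ cauchy 1ₜ (tpow a) k                    ≡⟨ ℤP.+-identityˡ _ ⟩
    cauchy 1ₜ (tpow a) k                             ≡⟨ cauchy-identityˡ (tpow a) k ⟩
    tpow a k                                         ∎)

tpow-+ : ∀ a b → tpow (a + b) ≋ tpow a ⊗ tpow b
tpow-+ zero    b = ≋-sym (≋-trans (⊗-cong tpow-zero ≋-refl) (⊗-identityˡ (tpow b)))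
tpow-+ (suc a) b = begin
  tpow (suc (a + b))             ≈⟨ tpow-suc (a + b) ⟩
  tpow 1 ⊗ tpow (a + b)          ≈⟨ ⊗-cong ≋-refl (tpow-+ a b) ⟩
  tpow 1 ⊗ (tpow a ⊗ tpow b)     ≈⟨ ⊗-assoc _ _ _ ⟨
  (tpow 1 ⊗ tpow a) ⊗ tpow b     ≈⟨ ⊗-cong (tpow-suc a) ≋-refl ⟨
  tpow (suc a) ⊗ tpow b          ∎
  where open ≋-Reasoning

signₜ-suc : ∀ k → signₜ (suc k) ≋ ⊖ 1ₜ ⊗ signₜ k
signₜ-suc zero          = ≋-trans (-ₜ≋⊖ 1ₜ) (≋-sym (⊗-identityʳ _))
signₜ-suc (suc zero)    = ≋-trans (solve 0 (𝟏 := (:- 𝟏) :* (:- 𝟏)) ≋-refl)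
                                  (⊗-cong ≋-refl (≋-sym (-ₜ≋⊖ 1ₜ)))
signₜ-suc (suc (suc k)) = signₜ-suc k

Sum : List Zt → Zt
Sum = foldr _⊕_ 0ₜ

module _ {A : Set} where

  sumₜ≋Sum : ∀ (f g : A → Zt) xs → (∀ x → f x ≋ g x) → sumₜ (map f xs) ≋ Sum (map g xs)
  sumₜ≋Sum f g []       f≋g = ≋-refl
  sumₜ≋Sum f g (x ∷ xs) f≋g = ≋-trans (+ₜ≋⊕ (f x) _) (⊕-cong (f≋g x) (sumₜ≋Sum f g xs f≋g))

  Sum-cong : ∀ (f g : A → Zt) xs → (∀ x → f x ≋ g x) → Sum (map f xs) ≋ Sum (map g xs)
  Sum-cong f g []       f≋g = ≋-refl
  Sum-cong f g (x ∷ xs) f≋g = ⊕-cong (f≋g x) (Sum-cong f g xs f≋g)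

  Sum-cong-∈ : ∀ (f g : A → Zt) xs → (∀ x → x ∈ xs → f x ≋ g x) →
               Sum (map f xs) ≋ Sum (map g xs)
  Sum-cong-∈ f g []       f≋g = ≋-refl
  Sum-cong-∈ f g (x ∷ xs) f≋g =
    ⊕-cong (f≋g x (here refl)) (Sum-cong-∈ f g xs λ y y∈ → f≋g y (there y∈))

  Sum-++ : ∀ (f : A → Zt) xs ys → Sum (map f (xs ++ ys)) ≋ Sum (map f xs) ⊕ Sum (map f ys)
  Sum-++ f []       ys = ≋-sym (⊕-identityˡ _)
  Sum-++ f (x ∷ xs) ys = ≋-trans (⊕-cong ≋-refl (Sum-++ f xs ys)) (≋-sym (⊕-assoc (f x) _ _))

  Sum-distribˡ : ∀ c (f : A → Zt) xs → Sum (map (λ x → c ⊗ f x) xs) ≋ c ⊗ Sum (map f xs)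
  Sum-distribˡ c f []       = ≋-sym (zeroʳ c)
  Sum-distribˡ c f (x ∷ xs) =
    ≋-trans (⊕-cong ≋-refl (Sum-distribˡ c f xs)) (≋-sym (⊗-distribˡ-⊕ c (f x) _))

  Sum-distribʳ : ∀ c (f : A → Zt) xs → Sum (map (λ x → f x ⊗ c) xs) ≋ Sum (map f xs) ⊗ c
  Sum-distribʳ c f []       = ≋-sym (zeroˡ c)
  Sum-distribʳ c f (x ∷ xs) =
    ≋-trans (⊕-cong ≋-refl (Sum-distribʳ c f xs)) (≋-sym (⊗-distribʳ-⊕ c (f x) _))

  Sum-zero : ∀ (xs : List A) → Sum (map (λ _ → 0ₜ) xs) ≋ 0ₜ
  Sum-zero []       = ≋-refl
  Sum-zero (x ∷ xs) = ≋-trans (⊕-identityˡ _) (Sum-zero xs)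

  Sum-⊕ : ∀ (f g : A → Zt) xs → Sum (map (λ x → f x ⊕ g x) xs) ≋ Sum (map f xs) ⊕ Sum (map g xs)
  Sum-⊕ f g []       = ≋-sym (⊕-identityˡ 0ₜ)
  Sum-⊕ f g (x ∷ xs) =
    ≋-trans (⊕-cong ≋-refl (Sum-⊕ f g xs)) (⊕.interchange (f x) (g x) (Sum (map f xs)) (Sum (map g xs)))

module _ {A B : Set} where

  Sum-map : ∀ (f : B → Zt) (g : A → B) xs → Sum (map f (map g xs)) ≡ Sum (map (λ x → f (g x)) xs)
  Sum-map f g xs = cong Sum (sym (ListP.map-∘ xs))

  Sum-swap : ∀ (f : A → B → Zt) xs ys →
    Sum (map (λ x → Sum (map (f x) ys)) xs) ≋ Sum (map (λ y → Sum (map (λ x → f x y) xs)) ys)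
  Sum-swap f []       ys = ≋-sym (Sum-zero ys)
  Sum-swap f (x ∷ xs) ys =
    ≋-trans (⊕-cong ≋-refl (Sum-swap f xs ys))
            (≋-sym (Sum-⊕ (f x) (λ y → Sum (map (λ x → f x y) xs)) ys))

-- Compositions as bit vectors

-- Bit vectors are read as if padded with false on the right.
hd : List Bool → Bool
hd []      = false
hd (x ∷ _) = x

tl : List Bool → List Bool
tl []       = []
tl (_ ∷ xs) = xs

positions : ℕ → List Bool → List ℕ
positions o []           = []
positions o (true  ∷ bs) = o ∷ positions (suc o) bs
positions o (false ∷ bs) = positions (suc o) bs

bitsToComp : List Bool → List ℕ
bitsToComp []           = 1 ∷ []
bitsToComp (true  ∷ bs) = 1 ∷ bitsToComp bs
bitsToComp (false ∷ bs) = incHead (bitsToComp bs)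

allBits : ℕ → List (List Bool)
allBits zero    = [] ∷ []
allBits (suc m) = map (true ∷_) (allBits m) ++ map (false ∷_) (allBits m)

∈-allBits⇒length : ∀ {m bs} → bs ∈ allBits m → length bs ≡ m
∈-allBits⇒length {zero}  (here refl) = refl
∈-allBits⇒length {suc m} {bs} bs∈ with ∈-++⁻ (map (true ∷_) (allBits m)) bs∈
... | inj₁ bs∈₁ with ∈-map⁻ (true ∷_) bs∈₁
...   | _ , bs′∈ , refl = cong suc (∈-allBits⇒length bs′∈)
∈-allBits⇒length {suc m} {bs} bs∈ | inj₂ bs∈₂ with ∈-map⁻ (false ∷_) bs∈₂
...   | _ , bs′∈ , refl = cong suc (∈-allBits⇒length bs′∈)

ones : List Bool → ℕ
ones []           = 0
ones (true  ∷ bs) = suc (ones bs)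
ones (false ∷ bs) = ones bs

comps≡map-bitsToComp : ∀ m → comps (suc m) ≡ map bitsToComp (allBits m)
comps≡map-bitsToComp zero = refl
comps≡map-bitsToComp (suc m) = begin
  map (1 ∷_) (comps (suc m)) ++ map incHead (comps (suc m))
    ≡⟨ cong (λ cs → map (1 ∷_) cs ++ map incHead cs) (comps≡map-bitsToComp m) ⟩
  map (1 ∷_) (map bitsToComp X) ++ map incHead (map bitsToComp X)
    ≡⟨ cong₂ _++_ (ListP.map-∘ X) (ListP.map-∘ X) ⟨
  map (λ bs → bitsToComp (true ∷ bs)) X ++ map (λ bs → bitsToComp (false ∷ bs)) X
    ≡⟨ cong₂ _++_ (ListP.map-∘ X) (ListP.map-∘ X) ⟩
  map bitsToComp (map (true ∷_) X) ++ map bitsToComp (map (false ∷_) X)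
    ≡⟨ ListP.map-++ bitsToComp (map (true ∷_) X) (map (false ∷_) X) ⟨
  map bitsToComp (allBits (suc m)) ∎
  where
  open ≡-Reasoning
  X = allBits m

bitsToComp-∷ : ∀ bs → Σ ℕ λ h → Σ (List ℕ) λ t → bitsToComp bs ≡ suc h ∷ t
bitsToComp-∷ []           = 0 , [] , refl
bitsToComp-∷ (true  ∷ bs) = 0 , bitsToComp bs , refl
bitsToComp-∷ (false ∷ bs) with bitsToComp bs | bitsToComp-∷ bs
... | _ | h , t , refl = suc h , t , refl

map-+-positions : ∀ k o bs → map (k +_) (positions o bs) ≡ positions (k + o) bs
map-+-positions k o []           = refl
map-+-positions k o (true  ∷ bs) rewrite map-+-positions k (suc o) bs | ℕP.+-suc k o = refl
map-+-positions k o (false ∷ bs) rewrite map-+-positions k (suc o) bs | ℕP.+-suc k o = refl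

sub-incHead : ∀ α → sub (incHead α) ≡ map suc (sub α)
sub-incHead []          = refl
sub-incHead (a ∷ [])    = refl
sub-incHead (a ∷ b ∷ α) = cong (suc a ∷_) (ListP.map-∘ (sub (b ∷ α)))

sub-bitsToComp : ∀ bs → sub (bitsToComp bs) ≡ positions 1 bs
sub-bitsToComp [] = refl
sub-bitsToComp (true ∷ bs) with bitsToComp bs | bitsToComp-∷ bs | sub-bitsToComp bs
... | _ | h , t , refl | eq = cong (1 ∷_) (trans (cong (map suc) eq) (map-+-positions 1 1 bs))
sub-bitsToComp (false ∷ bs) =
  trans (sub-incHead (bitsToComp bs)) (trans (cong (map suc) (sub-bitsToComp bs)) (map-+-positions 1 1 bs))

length-incHead : ∀ α → length (incHead α) ≡ length α
length-incHead []      = refl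
length-incHead (_ ∷ _) = refl

length-bitsToComp : ∀ bs → length (bitsToComp bs) ≡ suc (ones bs)
length-bitsToComp []           = refl
length-bitsToComp (true  ∷ bs) = cong suc (length-bitsToComp bs)
length-bitsToComp (false ∷ bs) = trans (length-incHead (bitsToComp bs)) (length-bitsToComp bs)

positions-replicate : ∀ o k bs → positions o (replicate k false ++ bs) ≡ positions (k + o) bs
positions-replicate o zero    bs = refl
positions-replicate o (suc k) bs rewrite positions-replicate (suc o) k bs | ℕP.+-suc k o = refl

bitCode : ∀ m α → All (1 ≤_) α → sum α ≡ suc m →
          Σ (List Bool) λ bs → length bs ≡ m × sub α ≡ positions 1 bs
bitCode m [] _ ()
bitCode m (a ∷ []) _ _ = replicate m false , ListP.length-replicate m ,
  sym (trans (cong (positions 1) (sym (ListP.++-identityʳ (replicate m false)))) (positions-replicate 1 m []))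
bitCode m (zero ∷ _ ∷ _) (() ∷ _) _
bitCode m (suc _ ∷ zero ∷ _) (_ ∷ () ∷ _) _
bitCode m (suc a ∷ suc b ∷ α) (_ ∷ pos) eq with bitCode (b + sum α) (suc b ∷ α) pos refl
... | bs , len , sub≡ = replicate a false ++ true ∷ bs , length≡ , positions≡
  where
  open ≡-Reasoning
  length≡ : length (replicate a false ++ true ∷ bs) ≡ m
  length≡ = begin
    length (replicate a false ++ true ∷ bs)   ≡⟨ ListP.length-++ (replicate a false) ⟩
    length (replicate a false) + suc (length bs)
                                             ≡⟨ cong₂ (λ k l → k + suc l) (ListP.length-replicate a) len ⟩
    a + suc (b + sum α)                      ≡⟨ ℕP.suc-injective eq ⟩
    m                                        ∎
  positions≡ : suc a ∷ map (suc a +_) (sub (suc b ∷ α)) ≡ positions 1 (replicate a false ++ true ∷ bs)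
  positions≡ = begin
    suc a ∷ map (suc a +_) (sub (suc b ∷ α))   ≡⟨ cong (λ L → suc a ∷ map (suc a +_) L) sub≡ ⟩
    suc a ∷ map (suc a +_) (positions 1 bs)    ≡⟨ cong (suc a ∷_) (map-+-positions (suc a) 1 bs) ⟩
    suc a ∷ positions (suc a + 1) bs           ≡⟨ cong (_∷ positions (suc (a + 1)) bs) (ℕP.+-comm 1 a) ⟩
    positions (a + 1) (true ∷ bs)              ≡⟨ positions-replicate 1 a (true ∷ bs) ⟨
    positions 1 (replicate a false ++ true ∷ bs) ∎

noAdjacentOnes : List Bool → Bool
noAdjacentOnes []       = true
noAdjacentOnes (x ∷ bs) = not (x ∧ hd bs) ∧ noAdjacentOnes bs

noAdjacentOnes-positions : ∀ o bs → (∀ x → x ∈ positions o bs → suc x ∈ positions o bs → ⊥) →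
                           noAdjacentOnes bs ≡ true
noAdjacentOnes-positions o []                  _ = refl
noAdjacentOnes-positions o (true ∷ [])         _ = refl
noAdjacentOnes-positions o (true ∷ true ∷ bs)  h = ⊥-elim (h o (here refl) (there (here refl)))
noAdjacentOnes-positions o (true ∷ false ∷ bs) h =
  noAdjacentOnes-positions (suc o) (false ∷ bs) λ x p q → h x (there p) (there q)
noAdjacentOnes-positions o (false ∷ bs)        h = noAdjacentOnes-positions (suc o) bs h

≡ᵇ-refl : ∀ x → (x ≡ᵇ x) ≡ true
≡ᵇ-refl zero    = refl
≡ᵇ-refl (suc x) = ≡ᵇ-refl x

≡ᵇ-true⇒≡ : ∀ x y → (x ≡ᵇ y) ≡ true → x ≡ y
≡ᵇ-true⇒≡ zero    zero    _ = refl
≡ᵇ-true⇒≡ (suc x) (suc y) e = cong suc (≡ᵇ-true⇒≡ x y e)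

≢⇒≡ᵇ-false : ∀ {x y} → x ≢ y → (x ≡ᵇ y) ≡ false
≢⇒≡ᵇ-false {x} {y} x≢y with x ≡ᵇ y in eq
... | true  = ⊥-elim (x≢y (≡ᵇ-true⇒≡ x y eq))
... | false = refl

bitAt : ℕ → List Bool → ℕ → Bool
bitAt o []       x = false
bitAt o (b ∷ bs) x = if x ≡ᵇ o then b else bitAt (suc o) bs x

bitAt-< : ∀ o bs x → x < o → bitAt o bs x ≡ false
bitAt-< o []       x x<o = refl
bitAt-< o (b ∷ bs) x x<o
  rewrite ≢⇒≡ᵇ-false (ℕP.<⇒≢ x<o) = bitAt-< (suc o) bs x (ℕP.m<n⇒m<1+n x<o)

bitAt-first : ∀ o bs → bitAt o bs o ≡ hd bs
bitAt-first o []       = refl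
bitAt-first o (b ∷ bs) rewrite ≡ᵇ-refl o = refl

bitAt-> : ∀ o bs x → o < x → bitAt o bs x ≡ bitAt (suc o) (tl bs) x
bitAt-> o []       x o<x = refl
bitAt-> o (b ∷ bs) x o<x rewrite ≢⇒≡ᵇ-false (ℕP.>⇒≢ o<x) = refl

∈ᵇ-positions : ∀ o bs x → (x ∈ᵇ positions o bs) ≡ bitAt o bs x
∈ᵇ-positions o [] x = refl
∈ᵇ-positions o (true ∷ bs) x with x ≡ᵇ o
... | true  = refl
... | false = ∈ᵇ-positions (suc o) bs x
∈ᵇ-positions o (false ∷ bs) x with x ≡ᵇ o in eq
... | true rewrite ≡ᵇ-true⇒≡ x o eq =
  trans (∈ᵇ-positions (suc o) bs o) (bitAt-< (suc o) bs o (ℕP.n<1+n o))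
... | false = ∈ᵇ-positions (suc o) bs x

∈ᵇ-++ : ∀ x xs ys → (x ∈ᵇ (xs ++ ys)) ≡ (x ∈ᵇ xs) ∨ (x ∈ᵇ ys)
∈ᵇ-++ x []       ys = refl
∈ᵇ-++ x (y ∷ xs) ys rewrite ∈ᵇ-++ x xs ys = sym (BoolP.∨-assoc (x ≡ᵇ y) _ _)

∈ᵇ-filterB : ∀ (p : ℕ → Bool) x xs → (x ∈ᵇ filterB p xs) ≡ p x ∧ (x ∈ᵇ xs)
∈ᵇ-filterB p x [] = sym (BoolP.∧-zeroʳ (p x))
∈ᵇ-filterB p x (y ∷ xs) with p y in py
... | true with x ≡ᵇ y in x≡ᵇy
...   | true  rewrite ≡ᵇ-true⇒≡ x y x≡ᵇy | py = refl
...   | false = ∈ᵇ-filterB p x xs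
∈ᵇ-filterB p x (y ∷ xs) | false with x ≡ᵇ y in x≡ᵇy
...   | true  rewrite ≡ᵇ-true⇒≡ x y x≡ᵇy | ∈ᵇ-filterB p y xs | py = refl
...   | false = ∈ᵇ-filterB p x xs

∈ᵇ-map-suc : ∀ x xs → (suc x ∈ᵇ map suc xs) ≡ (x ∈ᵇ xs)
∈ᵇ-map-suc x []       = refl
∈ᵇ-map-suc x (y ∷ xs) rewrite ∈ᵇ-map-suc x xs = refl

∈ᵇ-map-pred : ∀ x xs → (suc x ∈ᵇ map (_∸ 1) xs) ≡ (suc (suc x) ∈ᵇ xs)
∈ᵇ-map-pred x []           = refl
∈ᵇ-map-pred x (zero  ∷ xs) = ∈ᵇ-map-pred x xs
∈ᵇ-map-pred x (suc y ∷ xs) rewrite ∈ᵇ-map-pred x xs = refl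

∈ᵇ-shiftDown : ∀ x A → (suc x ∈ᵇ shiftDown A) ≡ (suc (suc x) ∈ᵇ A)
∈ᵇ-shiftDown x A = trans (∈ᵇ-filterB _ (suc x) (map (_∸ 1) A)) (∈ᵇ-map-pred x A)

∈ᵇ-shiftUp : ∀ n x B → suc x < n → (suc x ∈ᵇ shiftUp n B) ≡ (x ∈ᵇ B)
∈ᵇ-shiftUp n x B x<n rewrite ∈ᵇ-filterB (λ y → not (y ≡ᵇ n)) (suc x) (map suc B)
  | ≢⇒≡ᵇ-false (ℕP.<⇒≢ x<n) = ∈ᵇ-map-suc x B

∈ᵇ-symDiff : ∀ x A B → (x ∈ᵇ symDiff A B) ≡ (x ∈ᵇ A) xor (x ∈ᵇ B)
∈ᵇ-symDiff x A B
  rewrite ∈ᵇ-++ x (filterB (λ y → not (y ∈ᵇ B)) A) (filterB (λ y → not (y ∈ᵇ A)) B)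
        | ∈ᵇ-filterB (λ y → not (y ∈ᵇ B)) x A | ∈ᵇ-filterB (λ y → not (y ∈ᵇ A)) x B
  with x ∈ᵇ A | x ∈ᵇ B
... | true  | true  = refl
... | true  | false = refl
... | false | true  = refl
... | false | false = refl

-- f is applied to the bit of ds at a one of as and to the bit of ds just before
-- it; p stands for the bit before the first.
localCond : (Bool → Bool → Bool) → Bool → List Bool → List Bool → Bool
localCond f p []       ds = true
localCond f p (a ∷ as) ds = (if a then f (hd ds) p else true) ∧ localCond f (hd ds) as (tl ds)

bitBefore : ℕ → Bool → List Bool → ℕ → Bool
bitBefore o p ds x = if x ≡ᵇ o then p else bitAt o ds (x ∸ 1)

bitBefore-> : ∀ o p ds x → o < x → bitBefore o p ds x ≡ bitBefore (suc o) (hd ds) (tl ds) x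
bitBefore-> o p ds (suc x) (s≤s o≤x)
  rewrite ≢⇒≡ᵇ-false (ℕP.>⇒≢ (s≤s o≤x)) with ℕP.≤⇒≤′ o≤x
... | ≤′-refl rewrite ≡ᵇ-refl x = bitAt-first x ds
... | ≤′-step o<x rewrite ≢⇒≡ᵇ-false (ℕP.>⇒≢ (s≤s (ℕP.≤′⇒≤ o<x))) =
  bitAt-> o ds x (s≤s (ℕP.≤′⇒≤ o<x))

LocalMembership : (Bool → Bool → Bool) → List ℕ → ℕ → Bool → List Bool → ℕ → Set
LocalMembership f X o p ds n =
  ∀ x → o ≤ x → x < o + n → (x ∈ᵇ X) ≡ f (bitAt o ds x) (bitBefore o p ds x)

LocalMembership-suc : ∀ f X o p ds n →
  LocalMembership f X o p ds (suc n) → LocalMembership f X (suc o) (hd ds) (tl ds) n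
LocalMembership-suc f X o p ds n local x o<x x<o+1+n =
  trans (local x (ℕP.<⇒≤ o<x) (subst (x <_) (sym (ℕP.+-suc o n)) x<o+1+n))
        (cong₂ f (bitAt-> o ds x o<x) (bitBefore-> o p ds x o<x))

⊆ᵇ-positions-local : ∀ f X o p as ds → LocalMembership f X o p ds (length as) →
                     (positions o as ⊆ᵇ X) ≡ localCond f p as ds
⊆ᵇ-positions-local f X o p []           ds _     = refl
⊆ᵇ-positions-local f X o p (true  ∷ as) ds local =
  cong₂ _∧_ (trans (local o ℕP.≤-refl (ℕP.m<m+n o (s≤s z≤n))) atFirst)
            (⊆ᵇ-positions-local f X (suc o) (hd ds) as (tl ds) (LocalMembership-suc f X o p ds _ local))
  where
  atFirst : f (bitAt o ds o) (bitBefore o p ds o) ≡ f (hd ds) p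
  atFirst rewrite bitAt-first o ds | ≡ᵇ-refl o = refl
⊆ᵇ-positions-local f X o p (false ∷ as) ds local =
  ⊆ᵇ-positions-local f X (suc o) (hd ds) as (tl ds) (LocalMembership-suc f X o p ds _ local)

∈ᵇ-shiftUp-positions : ∀ m ds x → 1 ≤ x → x < suc m →
  (x ∈ᵇ shiftUp (suc m) (positions 1 ds)) ≡ bitBefore 1 false ds x
∈ᵇ-shiftUp-positions m ds (suc zero) _ x<n rewrite ∈ᵇ-shiftUp (suc m) zero (positions 1 ds) x<n =
  trans (∈ᵇ-positions 1 ds 0) (bitAt-< 1 ds 0 (s≤s z≤n))
∈ᵇ-shiftUp-positions m ds (suc (suc x)) _ x<n rewrite ∈ᵇ-shiftUp (suc m) (suc x) (positions 1 ds) x<n =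
  ∈ᵇ-positions 1 ds (suc x)

peakCond-bits : ∀ m as ds → length as ≡ m →
  (positions 1 as ⊆ᵇ symDiff (positions 1 ds) (shiftUp (suc m) (positions 1 ds)))
    ≡ localCond _xor_ false as ds
peakCond-bits m as ds refl =
  ⊆ᵇ-positions-local _xor_ (symDiff D (shiftUp (suc m) D)) 1 false as ds λ x 1≤x x<n →
  trans (∈ᵇ-symDiff x D (shiftUp (suc m) D))
        (cong₂ _xor_ (∈ᵇ-positions 1 ds x) (∈ᵇ-shiftUp-positions m ds x 1≤x x<n))
  where D = positions 1 ds

coverCond-bits : ∀ m as bs → length as ≡ m →
  (positions 1 as ⊆ᵇ (positions 1 bs ∪ shiftUp (suc m) (positions 1 bs)))
    ≡ localCond _∨_ false as bs
coverCond-bits m as bs refl =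
  ⊆ᵇ-positions-local _∨_ (B ∪ shiftUp (suc m) B) 1 false as bs λ x 1≤x x<n →
  trans (∈ᵇ-++ x B (shiftUp (suc m) B))
        (cong₂ _∨_ (∈ᵇ-positions 1 bs x) (∈ᵇ-shiftUp-positions m bs x 1≤x x<n))
  where B = positions 1 bs

infix 4 _⊑_
_⊑_ : List Bool → List Bool → Bool
[]       ⊑ ds = true
(b ∷ bs) ⊑ ds = (if b then hd ds else true) ∧ (bs ⊑ tl ds)

localCond-here : ∀ p bs ds → localCond (λ y _ → y) p bs ds ≡ (bs ⊑ ds)
localCond-here p []       ds = refl
localCond-here p (b ∷ bs) ds = cong ((if b then hd ds else true) ∧_) (localCond-here (hd ds) bs (tl ds))

⊆ᵇ-positions : ∀ bs ds → (positions 1 bs ⊆ᵇ positions 1 ds) ≡ (bs ⊑ ds)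
⊆ᵇ-positions bs ds =
  trans (⊆ᵇ-positions-local (λ y _ → y) (positions 1 ds) 1 false bs ds λ x _ _ → ∈ᵇ-positions 1 ds x)
        (localCond-here false bs ds)

-- s(β, γ) read off the bits: j is the index of the current part of β, and
-- each cut of γ inside that part contributes j.
sᵇ : ℕ → List Bool → List Bool → ℕ
sᵇ j []           ds = 0
sᵇ j (true  ∷ bs) ds = sᵇ (suc j) bs (tl ds)
sᵇ j (false ∷ bs) ds = if hd ds then j + sᵇ j bs (tl ds) else sᵇ j bs (tl ds)

extraCuts : List Bool → List Bool → ℕ
extraCuts []           ds = 0
extraCuts (true  ∷ bs) ds = extraCuts bs (tl ds)
extraCuts (false ∷ bs) ds = if hd ds then suc (extraCuts bs (tl ds)) else extraCuts bs (tl ds)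

∧-true-elimʳ : ∀ x y → x ∧ y ≡ true → y ≡ true
∧-true-elimʳ true y e = e

s-bitsToComp : ∀ j bs ds → length bs ≡ length ds → (bs ⊑ ds) ≡ true →
  weighted j (blocks (bitsToComp bs) (bitsToComp ds)) ≡ sᵇ j bs ds
s-bitsToComp j [] [] _ _ = trans (ℕP.+-identityʳ _) (ℕP.*-zeroʳ j)
s-bitsToComp j (true ∷ bs) (true ∷ ds) len ⊑ =
  trans (cong (_+ weighted (suc j) (blocks (bitsToComp bs) (bitsToComp ds))) (ℕP.*-zeroʳ j))
        (s-bitsToComp (suc j) bs ds (ℕP.suc-injective len) ⊑)
s-bitsToComp j (false ∷ bs) (true ∷ ds) len ⊑
  with bitsToComp bs | bitsToComp-∷ bs | bitsToComp ds | bitsToComp-∷ ds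
     | s-bitsToComp j bs ds (ℕP.suc-injective len) ⊑
... | _ | h , t , refl | _ | g , gs , refl | ih =
  trans (cong (_+ weighted (suc j) (blocks t (proj₂ (takeParts (h ∸ g) gs))))
              (ℕP.*-suc j (proj₁ (takeParts (h ∸ g) gs))))
        (trans (ℕP.+-assoc j _ _) (cong (j +_) ih))
s-bitsToComp j (false ∷ bs) (false ∷ ds) len ⊑
  with bitsToComp bs | bitsToComp-∷ bs | bitsToComp ds | bitsToComp-∷ ds
     | s-bitsToComp j bs ds (ℕP.suc-injective len) ⊑
... | _ | h , t , refl | _ | g , gs , refl | ih = ih

ones-mono : ∀ bs ds → (bs ⊑ ds) ≡ true → ones bs ≤ ones ds
ones-mono []           ds           _ = z≤n
ones-mono (true  ∷ bs) (true  ∷ ds) ⊑ = s≤s (ones-mono bs ds ⊑)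
ones-mono (false ∷ bs) (true  ∷ ds) ⊑ = ℕP.m≤n⇒m≤1+n (ones-mono bs ds ⊑)
ones-mono (false ∷ bs) (false ∷ ds) ⊑ = ones-mono bs ds ⊑
ones-mono (false ∷ bs) []           ⊑ = ones-mono bs [] ⊑

ones-∸-ones : ∀ bs ds → length bs ≡ length ds → (bs ⊑ ds) ≡ true →
              ones ds ∸ ones bs ≡ extraCuts bs ds
ones-∸-ones []           []           _   _ = refl
ones-∸-ones (true  ∷ bs) (true  ∷ ds) len ⊑ = ones-∸-ones bs ds (ℕP.suc-injective len) ⊑
ones-∸-ones (false ∷ bs) (true  ∷ ds) len ⊑ =
  trans (ℕP.+-∸-assoc 1 (ones-mono bs ds ⊑)) (cong suc (ones-∸-ones bs ds (ℕP.suc-injective len) ⊑))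
ones-∸-ones (false ∷ bs) (false ∷ ds) len ⊑ = ones-∸-ones bs ds (ℕP.suc-injective len) ⊑

-- The factor k(b) of k(α, β) for the j-th element b of sub β, where
-- u : b ∈ sub α ∪ (sub α - 1),  z : b ∈ sub α,  pb : b - 1 ∈ sub β.
kFactor : ℕ → Bool → Bool → Bool → Zt
kFactor j u z pb = if not u then 1ₜ ⊕ tpow j else if z ∧ pb then tpow (j ∸ 1) ⊕ tpow j else 1ₜ

isPredecessor : ℕ → Maybe ℕ → Bool
isPredecessor b nothing  = false
isPredecessor b (just p) = (b ∸ 1) ≡ᵇ p

kfac≋kFactor : ∀ A j prev b →
  kfac A j prev b ≋ kFactor j (b ∈ᵇ (A ∪ shiftDown A)) (b ∈ᵇ A) (isPredecessor b prev)
kfac≋kFactor A j prev b with b ∈ᵇ (A ∪ shiftDown A) | b ∈ᵇ A | prev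
... | false | _     | nothing = +ₜ≋⊕ 1ₜ (tpow j)
... | false | _     | just p  = +ₜ≋⊕ 1ₜ (tpow j)
... | true  | false | nothing = ≋-refl
... | true  | false | just p  = ≋-refl
... | true  | true  | nothing = ≋-refl
... | true  | true  | just p with (b ∸ 1) ≡ᵇ p
...   | true  = +ₜ≋⊕ (tpow (j ∸ 1)) (tpow j)
...   | false = ≋-refl

-- k(α, β) read off the bits of α and β; j indexes the next element of
-- sub β and pb says whether the previous position lies in sub β.
kᵇ : ℕ → Bool → List Bool → List Bool → Zt
kᵇ j pb as []           = 1ₜ
kᵇ j pb as (true  ∷ bs) = kFactor j (hd as ∨ hd (tl as)) (hd as) pb ⊗ kᵇ (suc j) true (tl as) bs
kᵇ j pb as (false ∷ bs) = kᵇ j false (tl as) bs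

Before : ℕ → Maybe ℕ → Set
Before o nothing  = ⊤
Before o (just p) = p < o

kfacs-positions : ∀ A j o prev as bs → Before (suc o) prev →
  (∀ x → suc o ≤ x → (x ∈ᵇ A) ≡ bitAt (suc o) as x) →
  prodₜ (kfacs A j prev (positions (suc o) bs)) ≋ kᵇ j (isPredecessor (suc o) prev) as bs
kfacs-positions A j o prev as []           _      _  = ≋-refl
kfacs-positions A j o prev as (true  ∷ bs) before A≡ =
  ≋-trans (*ₜ≋⊗ _ _) (⊗-cong first rest)
  where
  inA : (suc o ∈ᵇ A) ≡ hd as
  inA = trans (A≡ (suc o) ℕP.≤-refl) (bitAt-first (suc o) as)
  inA-1 : (suc o ∈ᵇ shiftDown A) ≡ hd (tl as)
  inA-1 = trans (∈ᵇ-shiftDown o A)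
            (trans (A≡ (suc (suc o)) (ℕP.n≤1+n _))
              (trans (bitAt-> (suc o) as (suc (suc o)) ℕP.≤-refl) (bitAt-first (suc (suc o)) (tl as))))
  first : kfac A j prev (suc o) ≋ kFactor j (hd as ∨ hd (tl as)) (hd as) (isPredecessor (suc o) prev)
  first = ≋-trans (kfac≋kFactor A j prev (suc o))
                  (≡⇒≋ (cong₂ (λ u z → kFactor j u z _)
                              (trans (∈ᵇ-++ (suc o) A (shiftDown A)) (cong₂ _∨_ inA inA-1)) inA))
  rest : prodₜ (kfacs A (suc j) (just (suc o)) (positions (suc (suc o)) bs)) ≋ kᵇ (suc j) true (tl as) bs
  rest = subst (λ q → prodₜ (kfacs A (suc j) (just (suc o)) (positions (suc (suc o)) bs))
                         ≋ kᵇ (suc j) q (tl as) bs)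
               (≡ᵇ-refl o)
               (kfacs-positions A (suc j) (suc o) (just (suc o)) (tl as) bs ℕP.≤-refl
                  λ x o<x → trans (A≡ x (ℕP.<⇒≤ o<x)) (bitAt-> (suc o) as x o<x))
kfacs-positions A j o prev as (false ∷ bs) before A≡ =
  subst (λ q → prodₜ (kfacs A j prev (positions (suc (suc o)) bs)) ≋ kᵇ j q (tl as) bs)
        (notPredecessor prev before)
        (kfacs-positions A j (suc o) prev (tl as) bs (stillBefore prev before)
           λ x o<x → trans (A≡ x (ℕP.<⇒≤ o<x)) (bitAt-> (suc o) as x o<x))
  where
  notPredecessor : ∀ prev → Before (suc o) prev → isPredecessor (suc (suc o)) prev ≡ false
  notPredecessor nothing  _   = refl
  notPredecessor (just p) p<o = ≢⇒≡ᵇ-false (ℕP.>⇒≢ p<o)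
  stillBefore : ∀ prev → Before (suc o) prev → Before (suc (suc o)) prev
  stillBefore nothing  _   = tt
  stillBefore (just p) p<o = ℕP.m<n⇒m<1+n p<o

-- Summing out β one position at a time

advance : Bool → ℕ → ℕ
advance true  j = suc j
advance false j = j

kStep : ℕ → Bool → Bool → Bool → Bool → Zt
kStep j pb z z′ true  = kFactor j (z ∨ z′) z pb
kStep j pb z z′ false = 1ₜ

-- An extra cut of γ inside the j-th part of β contributes -t^j.
sStep : ℕ → Bool → Bool → Zt
sStep j y     true  = 1ₜ
sStep j true  false = ⊖ 1ₜ ⊗ tpow j
sStep j false false = 1ₜ

-- The contribution of one position, with bits z of α (z′ at the next
-- position), y of γ and x of β, and pb the bit of β at the previous position.
weight : ℕ → Bool → Bool → Bool → Bool → Bool → Zt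
weight j pb z z′ y x =
  (𝟙 (if z then x ∨ pb else true) ⊗ 𝟙 (if x then y else true)) ⊗ (kStep j pb z z′ x ⊗ sStep j y x)

summand : ℕ → Bool → List Bool → List Bool → List Bool → Zt
summand j pb as ds bs =
  (if localCond _∨_ pb as bs then kᵇ j pb as bs else 0ₜ) ⊗
  (if bs ⊑ ds then signₜ (extraCuts bs ds) ⊗ tpow (sᵇ j bs ds) else 0ₜ)

kᵇ-∷ : ∀ j pb z as x bs →
       kᵇ j pb (z ∷ as) (x ∷ bs) ≋ kStep j pb z (hd as) x ⊗ kᵇ (advance x j) x as bs
kᵇ-∷ j pb z as true  bs = ≋-refl
kᵇ-∷ j pb z as false bs = ≋-sym (⊗-identityˡ _)

sign-tpow-∷ : ∀ j y ds x bs →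
  signₜ (extraCuts (x ∷ bs) (y ∷ ds)) ⊗ tpow (sᵇ j (x ∷ bs) (y ∷ ds))
    ≋ sStep j y x ⊗ (signₜ (extraCuts bs ds) ⊗ tpow (sᵇ (advance x j) bs ds))
sign-tpow-∷ j y     ds true  bs = ≋-sym (⊗-identityˡ _)
sign-tpow-∷ j false ds false bs = ≋-sym (⊗-identityˡ _)
sign-tpow-∷ j true  ds false bs =
  ≋-trans (⊗-cong (signₜ-suc (extraCuts bs ds)) (tpow-+ j (sᵇ j bs ds)))
          (solve 3 (λ S T U → ((:- 𝟏) :* S) :* (T :* U) := ((:- 𝟏) :* T) :* (S :* U)) ≋-refl
                 (signₜ (extraCuts bs ds)) (tpow j) (tpow (sᵇ j bs ds)))

summand-∷ : ∀ j pb z as y ds x bs →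
  summand j pb (z ∷ as) (y ∷ ds) (x ∷ bs)
    ≋ weight j pb z (hd as) y x ⊗ summand (advance x j) x as ds bs
summand-∷ j pb z as y ds x bs = begin
  (if c ∧ C then kᵇ j pb (z ∷ as) (x ∷ bs) else 0ₜ) ⊗ (if e ∧ E then ST else 0ₜ)
    ≈⟨ ⊗-cong (if-then-0≋𝟙⊗ (c ∧ C) _) (if-then-0≋𝟙⊗ (e ∧ E) _) ⟩
  (𝟙 (c ∧ C) ⊗ kᵇ j pb (z ∷ as) (x ∷ bs)) ⊗ (𝟙 (e ∧ E) ⊗ ST)
    ≈⟨ ⊗-cong (⊗-cong (𝟙-∧ c C) (kᵇ-∷ j pb z as x bs))
              (⊗-cong (𝟙-∧ e E) (sign-tpow-∷ j y ds x bs)) ⟩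
  ((𝟙 c ⊗ 𝟙 C) ⊗ (k ⊗ k′)) ⊗ ((𝟙 e ⊗ 𝟙 E) ⊗ (σ ⊗ ST′))
    ≈⟨ solve 8 (λ c C k k′ e E σ ST′ → ((c :* C) :* (k :* k′)) :* ((e :* E) :* (σ :* ST′))
                                    := ((c :* e) :* (k :* σ)) :* ((C :* k′) :* (E :* ST′)))
             ≋-refl (𝟙 c) (𝟙 C) k k′ (𝟙 e) (𝟙 E) σ ST′ ⟩
  ((𝟙 c ⊗ 𝟙 e) ⊗ (k ⊗ σ)) ⊗ ((𝟙 C ⊗ k′) ⊗ (𝟙 E ⊗ ST′))
    ≈⟨ ⊗-cong ≋-refl (⊗-cong (if-then-0≋𝟙⊗ C k′) (if-then-0≋𝟙⊗ E ST′)) ⟨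
  weight j pb z (hd as) y x ⊗ summand (advance x j) x as ds bs ∎
  where
  open ≋-Reasoning
  c = if z then x ∨ pb else true
  C = localCond _∨_ x as bs
  e = if x then y else true
  E = bs ⊑ ds
  ST = signₜ (extraCuts (x ∷ bs) (y ∷ ds)) ⊗ tpow (sᵇ j (x ∷ bs) (y ∷ ds))
  k = kStep j pb z (hd as) x
  k′ = kᵇ (advance x j) x as bs
  σ = sStep j y x
  ST′ = signₜ (extraCuts bs ds) ⊗ tpow (sᵇ (advance x j) bs ds)

partialSum : ℕ → Bool → List Bool → List Bool → Zt
partialSum j pb as ds = Sum (map (summand j pb as ds) (allBits (length as)))

partialSum-∷ : ∀ j pb z as y ds →
  partialSum j pb (z ∷ as) (y ∷ ds)
    ≋ weight j pb z (hd as) y true  ⊗ partialSum (suc j) true as ds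
    ⊕ weight j pb z (hd as) y false ⊗ partialSum j false as ds
partialSum-∷ j pb z as y ds =
  ≋-trans (Sum-++ f (map (true ∷_) X) (map (false ∷_) X)) (⊕-cong (firstBit true) (firstBit false))
  where
  X = allBits (length as)
  f = summand j pb (z ∷ as) (y ∷ ds)
  firstBit : ∀ x →
    Sum (map f (map (x ∷_) X)) ≋ weight j pb z (hd as) y x ⊗ partialSum (advance x j) x as ds
  firstBit x =
    subst (_≋ weight j pb z (hd as) y x ⊗ partialSum (advance x j) x as ds) (sym (Sum-map f (x ∷_) X))
          (≋-trans (Sum-cong _ _ X (summand-∷ j pb z as y ds x))
                   (Sum-distribˡ _ (summand (advance x j) x as ds) X))

-- The weight left at a position of sub α once the bit of β there is summed out.
leadFactor : ℕ → Bool → Bool → Zt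
leadFactor j pb false = 𝟙 pb
leadFactor j pb true  = if pb then tpow (j ∸ 1) else 1ₜ

closedForm : ℕ → Bool → List Bool → List Bool → Zt
closedForm j pb []           ds = 1ₜ
closedForm j pb (false ∷ as) ds = 𝟙 (localCond _xor_ (hd ds) as (tl ds))
closedForm j pb (true  ∷ as) ds = leadFactor j pb (hd ds) ⊗ 𝟙 (localCond _xor_ (hd ds) as (tl ds))

-- If α has a 0 at the next position, the closed form X of the rest does not depend
-- on the current bit of β.
sumOut-beforeZero : ∀ j pb z y X →
  weight j pb z false y true ⊗ X ⊕ weight j pb z false y false ⊗ X
    ≋ (if z then leadFactor j pb y ⊗ X else X)
sumOut-beforeZero j pb    false true  X =
  solve 2 (λ t x → ((𝟏 :* 𝟏) :* ((𝟏 :+ t) :* 𝟏)) :* x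
                   :+ ((𝟏 :* 𝟏) :* (𝟏 :* ((:- 𝟏) :* t))) :* x
                   := x) ≋-refl (tpow j) X
sumOut-beforeZero j pb    false false X =
  solve 2 (λ t x → ((𝟏 :* 𝟎) :* ((𝟏 :+ t) :* 𝟏)) :* x
                   :+ ((𝟏 :* 𝟏) :* (𝟏 :* 𝟏)) :* x
                   := x) ≋-refl (tpow j) X
sumOut-beforeZero j true  true  true  X =
  solve 3 (λ t t′ x → ((𝟏 :* 𝟏) :* ((t′ :+ t) :* 𝟏)) :* x
                      :+ ((𝟏 :* 𝟏) :* (𝟏 :* ((:- 𝟏) :* t))) :* x
                      := t′ :* x) ≋-refl (tpow j) (tpow (j ∸ 1)) X
sumOut-beforeZero j true  true  false X =
  solve 3 (λ t t′ x → ((𝟏 :* 𝟎) :* ((t′ :+ t) :* 𝟏)) :* x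
                      :+ ((𝟏 :* 𝟏) :* (𝟏 :* 𝟏)) :* x
                      := 𝟏 :* x) ≋-refl (tpow j) (tpow (j ∸ 1)) X
sumOut-beforeZero j false true  true  X =
  solve 2 (λ t x → ((𝟏 :* 𝟏) :* (𝟏 :* 𝟏)) :* x
                   :+ ((𝟎 :* 𝟏) :* (𝟏 :* ((:- 𝟏) :* t))) :* x
                   := 𝟏 :* x) ≋-refl (tpow j) X
sumOut-beforeZero j false true  false X =
  solve 2 (λ t x → ((𝟏 :* 𝟎) :* (𝟏 :* 𝟏)) :* x
                   :+ ((𝟎 :* 𝟏) :* (𝟏 :* 𝟏)) :* x
                   := 𝟎 :* x) ≋-refl (tpow j) X

sumOut-beforeOne : ∀ j pb y y′ X →
  weight j pb false true y true  ⊗ (leadFactor (suc j) true y′ ⊗ X)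
    ⊕ weight j pb false true y false ⊗ (leadFactor j false y′ ⊗ X)
    ≋ 𝟙 (y′ xor y) ⊗ X
sumOut-beforeOne j pb true  true  X =
  solve 2 (λ t x → ((𝟏 :* 𝟏) :* (𝟏 :* 𝟏)) :* (t :* x)
                   :+ ((𝟏 :* 𝟏) :* (𝟏 :* ((:- 𝟏) :* t))) :* (𝟏 :* x)
                   := 𝟎 :* x) ≋-refl (tpow j) X
sumOut-beforeOne j pb true  false X =
  solve 2 (λ t x → ((𝟏 :* 𝟏) :* (𝟏 :* 𝟏)) :* (𝟏 :* x)
                   :+ ((𝟏 :* 𝟏) :* (𝟏 :* ((:- 𝟏) :* t))) :* (𝟎 :* x)
                   := 𝟏 :* x) ≋-refl (tpow j) X
sumOut-beforeOne j pb false true  X =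
  solve 2 (λ t x → ((𝟏 :* 𝟎) :* (𝟏 :* 𝟏)) :* (t :* x)
                   :+ ((𝟏 :* 𝟏) :* (𝟏 :* 𝟏)) :* (𝟏 :* x)
                   := 𝟏 :* x) ≋-refl (tpow j) X
sumOut-beforeOne j pb false false X =
  solve 2 (λ t x → ((𝟏 :* 𝟎) :* (𝟏 :* 𝟏)) :* (𝟏 :* x)
                   :+ ((𝟏 :* 𝟏) :* (𝟏 :* 𝟏)) :* (𝟎 :* x)
                   := 𝟎 :* x) ≋-refl (tpow j) X

partialSum≋closedForm : ∀ j pb as ds → length ds ≡ length as → noAdjacentOnes as ≡ true →
  partialSum j pb as ds ≋ closedForm j pb as ds
partialSum≋closedForm j pb [] [] _ _ =
  ≋-trans (⊕-identityʳ _) (≋-trans (⊗-identityˡ _) (≋-trans (⊗-identityˡ _) tpow-zero))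
partialSum≋closedForm j pb (z ∷ as) (y ∷ ds) len noAdj =
  ≋-trans (partialSum-∷ j pb z as y ds)
    (≋-trans (⊕-cong (⊗-cong ≋-refl (partialSum≋closedForm (suc j) true as ds len′ noAdj′))
                     (⊗-cong ≋-refl (partialSum≋closedForm j false as ds len′ noAdj′)))
             (sumOut z as ds len′ noAdj))
  where
  len′ = ℕP.suc-injective len
  noAdj′ = ∧-true-elimʳ _ _ noAdj
  sumOut : ∀ z as ds → length ds ≡ length as → noAdjacentOnes (z ∷ as) ≡ true →
    weight j pb z (hd as) y true  ⊗ closedForm (suc j) true as ds
      ⊕ weight j pb z (hd as) y false ⊗ closedForm j false as ds
      ≋ closedForm j pb (z ∷ as) (y ∷ ds)
  sumOut false []           ds        _ _  = sumOut-beforeZero j pb false y 1ₜ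
  sumOut true  []           ds        _ _  = sumOut-beforeZero j pb true y 1ₜ
  sumOut false (false ∷ as) ds        _ _  = sumOut-beforeZero j pb false y _
  sumOut true  (false ∷ as) ds        _ _  = sumOut-beforeZero j pb true y _
  sumOut false (true ∷ as)  (y′ ∷ ds) _ _  =
    ≋-trans (sumOut-beforeOne j pb y y′ _) (≋-sym (𝟙-∧ (y′ xor y) _))
  sumOut true  (true ∷ as)  ds        _ ()   -- two consecutive elements of sub α

-- The expansion of K_α

GtoF : List ℕ → List ℕ → Zt
GtoF β γ = if sub β ⊆ᵇ sub γ then signₜ (length γ ∸ length β) ⊗ tpow (s β γ) else 0ₜ

isPeakTerm : ℕ → List ℕ → List ℕ → Bool
isPeakTerm n α γ = sub α ⊆ᵇ symDiff (sub γ) (shiftUp n (sub γ))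

K≋Sum-F : ∀ n α w → K n α w ≋ Sum (map (λ γ → 𝟙 (isPeakTerm n α γ) ⊗ F γ w) (comps n))
K≋Sum-F n α w = sumₜ≋Sum _ _ (comps n) λ γ → if-then-0≋𝟙⊗ (isPeakTerm n α γ) (F γ w)

G-summand≋GtoF : ∀ β γ w →
  (if sub β ⊆ᵇ sub γ then (signₜ (length γ ∸ length β) *ₜ tpow (s β γ)) *ₜ F γ w else 0ₜ)
    ≋ GtoF β γ ⊗ F γ w
G-summand≋GtoF β γ w with sub β ⊆ᵇ sub γ
... | true  = ≋-trans (*ₜ≋⊗ _ _) (⊗-cong (*ₜ≋⊗ _ _) ≋-refl)
... | false = ≋-sym (zeroˡ _)

expansionCoeff : ℕ → (List ℕ → Zt) → List ℕ → Zt
expansionCoeff n c γ = Sum (map (λ β → c β ⊗ GtoF β γ) (comps n))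

G-expansion≋Sum-F : ∀ n c w →
  sumₜ (map (λ β → c β *ₜ G n β w) (comps n))
    ≋ Sum (map (λ γ → expansionCoeff n c γ ⊗ F γ w) (comps n))
G-expansion≋Sum-F n c w = begin
  sumₜ (map (λ β → c β *ₜ G n β w) cs)
    ≈⟨ sumₜ≋Sum _ _ cs (λ β → ≋-trans (*ₜ≋⊗ _ _)
                                (⊗-cong ≋-refl (sumₜ≋Sum _ _ cs λ γ → G-summand≋GtoF β γ w))) ⟩
  Sum (map (λ β → c β ⊗ Sum (map (λ γ → GtoF β γ ⊗ F γ w) cs)) cs)
    ≈⟨ Sum-cong _ _ cs (λ β → ≋-sym (Sum-distribˡ (c β) (λ γ → GtoF β γ ⊗ F γ w) cs)) ⟩
  Sum (map (λ β → Sum (map (λ γ → c β ⊗ (GtoF β γ ⊗ F γ w)) cs)) cs)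
    ≈⟨ Sum-swap (λ β γ → c β ⊗ (GtoF β γ ⊗ F γ w)) cs cs ⟩
  Sum (map (λ γ → Sum (map (λ β → c β ⊗ (GtoF β γ ⊗ F γ w)) cs)) cs)
    ≈⟨ Sum-cong _ _ cs (λ γ → ≋-trans (Sum-cong _ _ cs λ β → ≋-sym (⊗-assoc _ _ _))
                                      (Sum-distribʳ (F γ w) (λ β → c β ⊗ GtoF β γ) cs)) ⟩
  Sum (map (λ γ → expansionCoeff n c γ ⊗ F γ w) cs) ∎
  where
  open ≋-Reasoning
  cs = comps n

GtoF-bits : ∀ bs ds → length bs ≡ length ds →
  GtoF (bitsToComp bs) (bitsToComp ds)
    ≋ (if bs ⊑ ds then signₜ (extraCuts bs ds) ⊗ tpow (sᵇ 1 bs ds) else 0ₜ)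
GtoF-bits bs ds len
  rewrite sub-bitsToComp bs | sub-bitsToComp ds | ⊆ᵇ-positions bs ds
        | length-bitsToComp bs | length-bitsToComp ds
  with bs ⊑ ds in ⊑
... | true  rewrite ones-∸-ones bs ds len ⊑ | s-bitsToComp 1 bs ds len ⊑ = ≋-refl
... | false = ≋-refl

coeffKG-bits : ∀ m α as bs → length as ≡ m → sub α ≡ positions 1 as →
  coeffKG (suc m) α (bitsToComp bs) ≋ (if localCond _∨_ false as bs then kᵇ 1 false as bs else 0ₜ)
coeffKG-bits m α as bs len sub≡
  rewrite sub≡ | sub-bitsToComp bs | coverCond-bits m as bs len
  with localCond _∨_ false as bs
... | true  = kfacs-positions (positions 1 as) 1 0 nothing as bs tt (λ x _ → ∈ᵇ-positions 1 as x)
... | false = ≋-refl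

closedForm-start : ∀ as ds → closedForm 1 false as ds ≋ 𝟙 (localCond _xor_ false as ds)
closedForm-start []           ds = ≋-refl
closedForm-start (false ∷ as) ds = ≋-refl
closedForm-start (true  ∷ as) ds with hd ds
... | true  = ⊗-identityˡ _
... | false = zeroˡ _

expansionCoeff-bits : ∀ m α as ds →
  length as ≡ m → sub α ≡ positions 1 as → noAdjacentOnes as ≡ true → length ds ≡ m →
  expansionCoeff (suc m) (coeffKG (suc m) α) (bitsToComp ds) ≋ 𝟙 (isPeakTerm (suc m) α (bitsToComp ds))
expansionCoeff-bits m α as ds refl sub≡ noAdj lenD = begin
  Sum (map (λ β → c β ⊗ GtoF β γ) (comps (suc m)))
    ≡⟨ cong (λ cs → Sum (map (λ β → c β ⊗ GtoF β γ) cs)) (comps≡map-bitsToComp m) ⟩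
  Sum (map (λ β → c β ⊗ GtoF β γ) (map bitsToComp (allBits m)))
    ≡⟨ Sum-map _ bitsToComp (allBits m) ⟩
  Sum (map (λ bs → c (bitsToComp bs) ⊗ GtoF (bitsToComp bs) γ) (allBits m))
    ≈⟨ Sum-cong-∈ _ _ (allBits m) (λ bs bs∈ →
         ⊗-cong (coeffKG-bits m α as bs refl sub≡)
                (GtoF-bits bs ds (trans (∈-allBits⇒length bs∈) (sym lenD)))) ⟩
  partialSum 1 false as ds
    ≈⟨ partialSum≋closedForm 1 false as ds lenD noAdj ⟩
  closedForm 1 false as ds
    ≈⟨ closedForm-start as ds ⟩
  𝟙 (localCond _xor_ false as ds)
    ≡⟨ cong 𝟙 (trans (cong₂ (λ A D → A ⊆ᵇ symDiff D (shiftUp (suc m) D)) sub≡ (sub-bitsToComp ds))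
                     (peakCond-bits m as ds refl)) ⟨
  𝟙 (isPeakTerm (suc m) α γ) ∎
  where
  open ≋-Reasoning
  c = coeffKG (suc m) α
  γ = bitsToComp ds

expansionCoeff≋𝟙 : ∀ n α → IsComp n α → NoConsec α → ∀ γ → γ ∈ comps n →
  expansionCoeff n (coeffKG n α) γ ≋ 𝟙 (isPeakTerm n α γ)
expansionCoeff≋𝟙 zero    []          _               _        _ (here refl) =
  ≋-trans (⊕-identityʳ _) (≋-trans (⊗-identityˡ _) (≋-trans (⊗-identityˡ _) tpow-zero))
expansionCoeff≋𝟙 zero    (zero ∷ _)  (() ∷ _ , _)    _        _ _
expansionCoeff≋𝟙 zero    (suc _ ∷ _) (_ , ())        _        _ _
expansionCoeff≋𝟙 (suc m) α           (pos , Σα)      noConsec γ γ∈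
  with bitCode m α pos Σα | ∈-map⁻ bitsToComp (subst (γ ∈_) (comps≡map-bitsToComp m) γ∈)
... | as , len , sub≡ | ds , ds∈ , refl =
  expansionCoeff-bits m α as ds len sub≡ noAdj (∈-allBits⇒length ds∈)
  where
  noAdj = noAdjacentOnes-positions 1 as λ x x∈ x+1∈ →
            noConsec x (subst (x ∈_) (sym sub≡) x∈) (subst (suc x ∈_) (sym sub≡) x+1∈)

-- The identity holds coefficientwise at every word w.
theorem5p6 : (n N : ℕ) (α : List ℕ) → IsComp n α → NoConsec α → n ≤ N →
    IsGExpansion n N (K n α) (coeffKG n α)
theorem5p6 n N α isComp noConsec _ w _ = get (begin
  K n α w
    ≈⟨ K≋Sum-F n α w ⟩
  Sum (map (λ γ → 𝟙 (isPeakTerm n α γ) ⊗ F γ w) (comps n))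
    ≈⟨ Sum-cong-∈ _ _ (comps n) (λ γ γ∈ →
         ⊗-cong (expansionCoeff≋𝟙 n α isComp noConsec γ γ∈) ≋-refl) ⟨
  Sum (map (λ γ → expansionCoeff n (coeffKG n α) γ ⊗ F γ w) (comps n))
    ≈⟨ G-expansion≋Sum-F n (coeffKG n α) w ⟨
  sumₜ (map (λ β → coeffKG n α β *ₜ G n β w) (comps n)) ∎)
  where open ≋-Reasoning
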